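{- Let $t\geq 1$ and $n\geq 1$, let $w\in S_{2n}$ be $t$-pop-stack-sortable, and let $\sigma$ be the sorting plan of order $t$ of $w$. Then $\sigma$ is a type-$B$ sorting plan if and only if $w\in B_n$.
   Context: On $S_m$, the pop-stack-sorting map $\mathrm{Pop}$ reverses each descending run (maximal consecutive decreasing subsequence) of the one-line notation, keeping entries of different runs in the same relative order; $w$ is $t$-pop-stack-sortable if $\mathrm{Pop}^t(w)$ is the identity. The sorting plan of order $t$ of a $t$-pop-stack-sortable $w\in S_m$ is the array with $t$ rows, row $k$ ($k\in[t]$) being the partition of the positions $1,\ldots,m$ into consecutive blocks given by the descending runs of $\mathrm{Pop}^{k-1}(w)$ (numbers deleted, only blocks kept); its length is $m$. A sorting plan is symmetric if it is unchanged under reflection through a central vertical axis, i.e., in each row the sequence of block lengths read left to right is a palindrome. A type-$B$ sorting plan is a symmetric sorting plan of even length. $B_n$ is the subgroup of $S_{2n}$ of permutations $w$ with $w_0ww_0=w$, $w_0=(2n)(2n-1)\cdots 1$. -}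

module Defs where

open import Data.Nat using (ℕ; zero; suc; _+_; _*_; _∸_; _<ᵇ_)
open import Data.Bool using (if_then_else_)
open import Data.List using (List; []; _∷_; foldr; concatMap; reverse; map; length; applyUpTo)
open import Data.List.Relation.Unary.All using (All)
open import Data.Product using (Σ; _×_)
open import Relation.Binary.PropositionalEquality using (_≡_)
open import Function using (id)

-- Permutations of [m] are lists in one-line notation with values 1..m.
IsPerm : ℕ → List ℕ → Set
IsPerm m w = Data.List.Relation.Binary.Permutation.Propositional._↭_ w (applyUpTo suc m)
  where import Data.List.Relation.Binary.Permutation.Propositional

idPerm : ℕ → List ℕ
idPerm m = applyUpTo suc m

runStep : ℕ → List (List ℕ) → List (List ℕ)
runStep x [] = (x ∷ []) ∷ []
runStep x ([] ∷ rs) = (x ∷ []) ∷ [] ∷ rs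
runStep x ((y ∷ r) ∷ rs) = if y <ᵇ x then (x ∷ y ∷ r) ∷ rs else (x ∷ []) ∷ (y ∷ r) ∷ rs

descRuns : List ℕ → List (List ℕ)
descRuns = foldr runStep []

Pop : List ℕ → List ℕ
Pop w = concatMap reverse (descRuns w)

Pop^ : ℕ → List ℕ → List ℕ
Pop^ zero w = w
Pop^ (suc k) w = Pop (Pop^ k w)

Sortable : ℕ → ℕ → List ℕ → Set
Sortable m t w = Pop^ t w ≡ idPerm m

sortingPlan : ℕ → List ℕ → List (List ℕ)
sortingPlan t w = applyUpTo (λ j → map length (descRuns (Pop^ j w))) t

Symmetric : List (List ℕ) → Set
Symmetric σ = All (λ row → reverse row ≡ row) σ

TypeBPlan : ℕ → List (List ℕ) → Set
TypeBPlan m σ = Symmetric σ × Σ ℕ (λ k → m ≡ k + k)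

-- w ∈ B_n ⊆ S_{2n}: w0 w w0 = w, with w0 = (2n)(2n-1)...1.
-- In one-line notation (w0 w w0)_i = 2n+1 - w_{2n+1-i}.
conjW0 : ℕ → List ℕ → List ℕ
conjW0 n w = map (λ x → suc (n + n) ∸ x) (reverse w)

InB : ℕ → List ℕ → Set
InB n w = conjW0 n w ≡ w

-- Conjugation by w₀ acts on one-line notation as the reverse-complement
-- v ↦ (N ∸ v_m) … (N ∸ v_1) with N = 2n+1.  It maps descending runs to
-- descending runs in reverse order, so it commutes with Pop and reverses every
-- row of the sorting plan; hence w ∈ B_n gives a symmetric plan.  Conversely, a
-- list is determined by the lengths of its descending runs together with its
-- image under Pop, so if the plan of w is symmetric then w and its
-- reverse-complement share all rows and (as both are t-pop-stack-sortable) their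
-- t-th Pop images; descending through the t rows shows that they are equal.
module Submission where

open import Defs
open import Data.Bool using (Bool; true; false; T)
open import Data.Empty using (⊥-elim)
open import Data.List
open import Data.List.Properties
open import Data.List.Relation.Binary.Permutation.Propositional
  using (_↭_; ↭-refl; ↭-sym; ↭-trans; ↭-reflexive)
open import Data.List.Relation.Binary.Permutation.Propositional.Properties
  using (↭-reverse; ++⁺; All-resp-↭)
open import Data.List.Relation.Unary.All using (All; []; _∷_)
open import Data.List.Relation.Unary.All.Properties using (applyUpTo⁺₁; applyUpTo⁻)
open import Data.Nat using (ℕ; zero; suc; _+_; _∸_; _<ᵇ_; _≤_; _<_; _≥_; z<s; s<s)
open import Data.Nat.Properties
open import Data.Product using (∃₂; _,_)
open import Data.Unit using (tt)
open import Function using (_∘_; flip; id)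
open import Function.Bundles using (_⇔_; mk⇔)
open import Relation.Binary.PropositionalEquality

private
  variable
    A B : Set

T-injective : ∀ {x y} → (T x → T y) → (T y → T x) → x ≡ y
T-injective {false} {false} _ _ = refl
T-injective {false} {true}  _ g = ⊥-elim (g tt)
T-injective {true}  {false} f _ = ⊥-elim (f tt)
T-injective {true}  {true}  _ _ = refl

<ᵇ-complement : ∀ {N a b} → b ≤ N → (N ∸ b <ᵇ N ∸ a) ≡ (a <ᵇ b)
<ᵇ-complement {N} {a} {b} b≤N = T-injective
  (λ p → <⇒<ᵇ {a} {b} (∸-cancelʳ-< (<ᵇ⇒< (N ∸ b) (N ∸ a) p)))
  (λ p → <⇒<ᵇ {N ∸ b} {N ∸ a} (∸-monoʳ-< (<ᵇ⇒< a b p) b≤N))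

adjacent : (A → A → B) → List A → List B
adjacent R []           = []
adjacent R (x ∷ [])     = []
adjacent R (x ∷ y ∷ xs) = R x y ∷ adjacent R (y ∷ xs)

adjacent-∷ʳ : ∀ (R : A → A → B) xs y z →
              adjacent R (xs ++ y ∷ z ∷ []) ≡ adjacent R (xs ∷ʳ y) ∷ʳ R y z
adjacent-∷ʳ R []           y z = refl
adjacent-∷ʳ R (x ∷ [])     y z = refl
adjacent-∷ʳ R (x ∷ x′ ∷ xs) y z = cong (R x x′ ∷_) (adjacent-∷ʳ R (x′ ∷ xs) y z)

adjacent-reverse : ∀ (R : A → A → B) xs →
                   adjacent R (reverse xs) ≡ reverse (adjacent (flip R) xs)
adjacent-reverse R []           = refl
adjacent-reverse R (x ∷ [])     = refl
adjacent-reverse R (x ∷ y ∷ xs) = begin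
  adjacent R (reverse (x ∷ y ∷ xs))          ≡⟨ cong (adjacent R) reverse-x∷y∷xs ⟩
  adjacent R (reverse xs ++ y ∷ x ∷ [])      ≡⟨ adjacent-∷ʳ R (reverse xs) y x ⟩
  adjacent R (reverse xs ∷ʳ y) ∷ʳ R y x      ≡⟨ cong (λ ys → adjacent R ys ∷ʳ R y x) (unfold-reverse y xs) ⟨
  adjacent R (reverse (y ∷ xs)) ∷ʳ R y x     ≡⟨ cong (_∷ʳ R y x) (adjacent-reverse R (y ∷ xs)) ⟩
  reverse (adjacent (flip R) (y ∷ xs)) ∷ʳ R y x ≡⟨ unfold-reverse (R y x) (adjacent (flip R) (y ∷ xs)) ⟨
  reverse (adjacent (flip R) (x ∷ y ∷ xs))   ∎
  where
  open ≡-Reasoning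
  reverse-x∷y∷xs : reverse (x ∷ y ∷ xs) ≡ reverse xs ++ y ∷ x ∷ []
  reverse-x∷y∷xs = begin
    reverse (x ∷ y ∷ xs)          ≡⟨ unfold-reverse x (y ∷ xs) ⟩
    reverse (y ∷ xs) ∷ʳ x         ≡⟨ cong (_∷ʳ x) (unfold-reverse y xs) ⟩
    (reverse xs ∷ʳ y) ∷ʳ x        ≡⟨ ++-assoc (reverse xs) (y ∷ []) (x ∷ []) ⟩
    reverse xs ++ y ∷ x ∷ []      ∎

adjacent-complement : ∀ N xs → All (_≤ N) xs →
                      adjacent (flip _<ᵇ_) (map (N ∸_) xs) ≡ adjacent _<ᵇ_ xs
adjacent-complement N []           _                = refl
adjacent-complement N (x ∷ [])     _                = refl
adjacent-complement N (x ∷ y ∷ xs) (_ ∷ y≤N ∷ xs≤N) =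
  cong₂ _∷_ (<ᵇ-complement y≤N) (adjacent-complement N (y ∷ xs) (y≤N ∷ xs≤N))

-- Lengths of the blocks of consecutive elements joined by `true`

incHead : List ℕ → List ℕ
incHead []       = []
incHead (k ∷ ks) = suc k ∷ ks

incLast : List ℕ → List ℕ
incLast []           = []
incLast (k ∷ [])     = suc k ∷ []
incLast (k ∷ l ∷ ks) = k ∷ incLast (l ∷ ks)

blockLengths : List Bool → List ℕ
blockLengths []           = 1 ∷ []
blockLengths (true  ∷ bs) = incHead (blockLengths bs)
blockLengths (false ∷ bs) = 1 ∷ blockLengths bs

blockLengths-nonEmpty : ∀ bs → ∃₂ λ k ks → blockLengths bs ≡ k ∷ ks
blockLengths-nonEmpty []           = 1 , [] , refl
blockLengths-nonEmpty (false ∷ bs) = 1 , blockLengths bs , refl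
blockLengths-nonEmpty (true  ∷ bs) with blockLengths bs | blockLengths-nonEmpty bs
... | _ | k , ks , refl = suc k , ks , refl

incHead-blockLengths-++ : ∀ bs ks → incHead (blockLengths bs ++ ks) ≡ incHead (blockLengths bs) ++ ks
incHead-blockLengths-++ bs ks with blockLengths bs | blockLengths-nonEmpty bs
... | _ | _ , _ , refl = refl

incLast-1∷blockLengths : ∀ bs → incLast (1 ∷ blockLengths bs) ≡ 1 ∷ incLast (blockLengths bs)
incLast-1∷blockLengths bs with blockLengths bs | blockLengths-nonEmpty bs
... | _ | _ , _ , refl = refl

incHead-incLast : ∀ ks → incHead (incLast ks) ≡ incLast (incHead ks)
incHead-incLast []           = refl
incHead-incLast (k ∷ [])     = refl
incHead-incLast (k ∷ l ∷ ks) = refl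

incLast-∷ʳ : ∀ ks k → incLast (ks ∷ʳ k) ≡ ks ∷ʳ suc k
incLast-∷ʳ []           k = refl
incLast-∷ʳ (l ∷ [])     k = refl
incLast-∷ʳ (l ∷ l′ ∷ ks) k = cong (l ∷_) (incLast-∷ʳ (l′ ∷ ks) k)

incLast-reverse : ∀ ks → incLast (reverse ks) ≡ reverse (incHead ks)
incLast-reverse []       = refl
incLast-reverse (k ∷ ks) = begin
  incLast (reverse (k ∷ ks))   ≡⟨ cong incLast (unfold-reverse k ks) ⟩
  incLast (reverse ks ∷ʳ k)    ≡⟨ incLast-∷ʳ (reverse ks) k ⟩
  reverse ks ∷ʳ suc k          ≡⟨ unfold-reverse (suc k) ks ⟨
  reverse (suc k ∷ ks)         ∎
  where open ≡-Reasoning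

blockLengths-∷ʳ-false : ∀ bs → blockLengths (bs ∷ʳ false) ≡ blockLengths bs ∷ʳ 1
blockLengths-∷ʳ-false []           = refl
blockLengths-∷ʳ-false (false ∷ bs) = cong (1 ∷_) (blockLengths-∷ʳ-false bs)
blockLengths-∷ʳ-false (true  ∷ bs) =
  trans (cong incHead (blockLengths-∷ʳ-false bs)) (incHead-blockLengths-++ bs _)

blockLengths-∷ʳ-true : ∀ bs → blockLengths (bs ∷ʳ true) ≡ incLast (blockLengths bs)
blockLengths-∷ʳ-true []           = refl
blockLengths-∷ʳ-true (false ∷ bs) =
  trans (cong (1 ∷_) (blockLengths-∷ʳ-true bs)) (sym (incLast-1∷blockLengths bs))
blockLengths-∷ʳ-true (true  ∷ bs) =
  trans (cong incHead (blockLengths-∷ʳ-true bs)) (incHead-incLast (blockLengths bs))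

blockLengths-reverse : ∀ bs → blockLengths (reverse bs) ≡ reverse (blockLengths bs)
blockLengths-reverse []           = refl
blockLengths-reverse (false ∷ bs) = begin
  blockLengths (reverse (false ∷ bs))   ≡⟨ cong blockLengths (unfold-reverse false bs) ⟩
  blockLengths (reverse bs ∷ʳ false)    ≡⟨ blockLengths-∷ʳ-false (reverse bs) ⟩
  blockLengths (reverse bs) ∷ʳ 1        ≡⟨ cong (_∷ʳ 1) (blockLengths-reverse bs) ⟩
  reverse (blockLengths bs) ∷ʳ 1        ≡⟨ unfold-reverse 1 (blockLengths bs) ⟨
  reverse (1 ∷ blockLengths bs)         ∎
  where open ≡-Reasoning
blockLengths-reverse (true ∷ bs) = begin
  blockLengths (reverse (true ∷ bs))    ≡⟨ cong blockLengths (unfold-reverse true bs) ⟩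
  blockLengths (reverse bs ∷ʳ true)     ≡⟨ blockLengths-∷ʳ-true (reverse bs) ⟩
  incLast (blockLengths (reverse bs))   ≡⟨ cong incLast (blockLengths-reverse bs) ⟩
  incLast (reverse (blockLengths bs))   ≡⟨ incLast-reverse (blockLengths bs) ⟩
  reverse (incHead (blockLengths bs))   ∎
  where open ≡-Reasoning

chop : List ℕ → List A → List (List A)
chop []       xs = []
chop (k ∷ ks) xs = take k xs ∷ chop ks (drop k xs)

take-length-++ : ∀ (xs ys : List A) → take (length xs) (xs ++ ys) ≡ xs
take-length-++ []       ys = refl
take-length-++ (x ∷ xs) ys = cong (x ∷_) (take-length-++ xs ys)

drop-length-++ : ∀ (xs ys : List A) → drop (length xs) (xs ++ ys) ≡ ys
drop-length-++ []       ys = refl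
drop-length-++ (x ∷ xs) ys = drop-length-++ xs ys

chop-concat : ∀ (xss : List (List A)) → chop (map length xss) (concat xss) ≡ xss
chop-concat []         = refl
chop-concat (xs ∷ xss) = cong₂ _∷_ (take-length-++ xs (concat xss))
  (trans (cong (chop (map length xss)) (drop-length-++ xs (concat xss))) (chop-concat xss))

runLengths : List ℕ → List ℕ
runLengths xs = map length (descRuns xs)

concat-runStep : ∀ x xss → concat (runStep x xss) ≡ x ∷ concat xss
concat-runStep x []               = refl
concat-runStep x ([] ∷ xss)       = refl
concat-runStep x ((y ∷ ys) ∷ xss) with y <ᵇ x
... | true  = refl
... | false = refl

concat-descRuns : ∀ xs → concat (descRuns xs) ≡ xs
concat-descRuns []       = refl
concat-descRuns (x ∷ xs) = trans (concat-runStep x (descRuns xs)) (cong (x ∷_) (concat-descRuns xs))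

descRuns-chop : ∀ xs → descRuns xs ≡ chop (runLengths xs) xs
descRuns-chop xs = sym (begin
  chop (runLengths xs) xs                         ≡⟨ cong (chop (runLengths xs)) (concat-descRuns xs) ⟨
  chop (runLengths xs) (concat (descRuns xs))     ≡⟨ chop-concat (descRuns xs) ⟩
  descRuns xs                                     ∎)
  where open ≡-Reasoning

descRuns-∷ : ∀ x xs → ∃₂ λ ys yss → descRuns (x ∷ xs) ≡ (x ∷ ys) ∷ yss
descRuns-∷ x []       = [] , [] , refl
descRuns-∷ x (y ∷ xs) with descRuns (y ∷ xs) | descRuns-∷ y xs
... | _ | ys , yss , refl with y <ᵇ x
...   | true  = y ∷ ys , yss , refl
...   | false = [] , (y ∷ ys) ∷ yss , refl

runLengths-∷ : ∀ x xs → runLengths (x ∷ xs) ≡ blockLengths (adjacent (flip _<ᵇ_) (x ∷ xs))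
runLengths-∷ x []       = refl
runLengths-∷ x (y ∷ xs) with descRuns (y ∷ xs) | descRuns-∷ y xs | runLengths-∷ y xs
... | _ | ys , yss , refl | ih with y <ᵇ x
...   | true  = cong incHead ih
...   | false = cong (1 ∷_) ih

Pop-↭ : ∀ xs → Pop xs ↭ xs
Pop-↭ xs = ↭-trans (reversing (descRuns xs)) (↭-reflexive (concat-descRuns xs))
  where
  reversing : ∀ (xss : List (List ℕ)) → concat (map reverse xss) ↭ concat xss
  reversing []         = ↭-refl
  reversing (xs ∷ xss) = ++⁺ (↭-reverse xs) (reversing xss)

Pop^-↭ : ∀ k xs → Pop^ k xs ↭ xs
Pop^-↭ zero    xs = ↭-refl
Pop^-↭ (suc k) xs = ↭-trans (Pop-↭ (Pop^ k xs)) (Pop^-↭ k xs)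

reverseComplement : ℕ → List ℕ → List ℕ
reverseComplement N xs = map (N ∸_) (reverse xs)

reverse-concat : ∀ (xss : List (List A)) → reverse (concat xss) ≡ concat (reverse (map reverse xss))
reverse-concat []         = refl
reverse-concat (xs ∷ xss) = begin
  reverse (xs ++ concat xss)                            ≡⟨ reverse-++ xs (concat xss) ⟩
  reverse (concat xss) ++ reverse xs                    ≡⟨ cong₂ _++_ (reverse-concat xss) (sym (++-identityʳ (reverse xs))) ⟩
  concat (reverse (map reverse xss)) ++ concat (reverse xs ∷ []) ≡⟨ concat-++ (reverse (map reverse xss)) _ ⟩
  concat (reverse (map reverse xss) ∷ʳ reverse xs)      ≡⟨ cong concat (unfold-reverse (reverse xs) (map reverse xss)) ⟨
  concat (reverse (map reverse (xs ∷ xss)))             ∎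
  where open ≡-Reasoning

reverseComplement-concat : ∀ N xss →
  reverseComplement N (concat xss) ≡ concat (reverse (map (reverseComplement N) xss))
reverseComplement-concat N xss = begin
  map (N ∸_) (reverse (concat xss))                     ≡⟨ cong (map (N ∸_)) (reverse-concat xss) ⟩
  map (N ∸_) (concat (reverse (map reverse xss)))       ≡⟨ concat-map (reverse (map reverse xss)) ⟨
  concat (map (map (N ∸_)) (reverse (map reverse xss))) ≡⟨ cong concat (reverse-map (map (N ∸_)) (map reverse xss)) ⟩
  concat (reverse (map (map (N ∸_)) (map reverse xss))) ≡⟨ cong (concat ∘ reverse) (map-∘ xss) ⟨
  concat (reverse (map (reverseComplement N) xss))      ∎
  where open ≡-Reasoning

length-reverseComplement : ∀ N xs → length (reverseComplement N xs) ≡ length xs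
length-reverseComplement N xs = trans (length-map (N ∸_) (reverse xs)) (length-reverse xs)

runLengths≡blockLengths : ∀ xs → 0 < length xs →
                          runLengths xs ≡ blockLengths (adjacent (flip _<ᵇ_) xs)
runLengths≡blockLengths (x ∷ xs) _ = runLengths-∷ x xs

runLengths-reverseComplement : ∀ N xs → All (_≤ N) xs →
  runLengths (reverseComplement N xs) ≡ reverse (runLengths xs)
runLengths-reverseComplement N []       _    = refl
runLengths-reverseComplement N (x ∷ xs) x∷xs≤N = begin
  runLengths (reverseComplement N v)
    ≡⟨ runLengths≡blockLengths (reverseComplement N v)
         (subst (0 <_) (sym (length-reverseComplement N v)) z<s) ⟩
  blockLengths (adjacent (flip _<ᵇ_) (map (N ∸_) (reverse v)))
    ≡⟨ cong blockLengths (adjacent-complement N (reverse v) (All-resp-↭ (↭-sym (↭-reverse v)) x∷xs≤N)) ⟩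
  blockLengths (adjacent _<ᵇ_ (reverse v))             ≡⟨ cong blockLengths (adjacent-reverse _<ᵇ_ v) ⟩
  blockLengths (reverse (adjacent (flip _<ᵇ_) v))      ≡⟨ blockLengths-reverse (adjacent (flip _<ᵇ_) v) ⟩
  reverse (blockLengths (adjacent (flip _<ᵇ_) v))      ≡⟨ cong reverse (runLengths-∷ x xs) ⟨
  reverse (runLengths v)                               ∎
  where
  open ≡-Reasoning
  v = x ∷ xs

-- The blocks on the right have the run lengths of the left-hand side, so they
-- are recovered from it by chop.
descRuns-reverseComplement : ∀ N xs → All (_≤ N) xs →
  descRuns (reverseComplement N xs) ≡ reverse (map (reverseComplement N) (descRuns xs))
descRuns-reverseComplement N xs xs≤N = begin
  descRuns (reverseComplement N xs)
    ≡⟨ descRuns-chop (reverseComplement N xs) ⟩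
  chop (runLengths (reverseComplement N xs)) (reverseComplement N xs)
    ≡⟨ cong₂ chop lengths-agree (cong (reverseComplement N) (concat-descRuns xs)) ⟨
  chop (map length rcRuns) (reverseComplement N (concat (descRuns xs)))
    ≡⟨ cong (chop (map length rcRuns)) (reverseComplement-concat N (descRuns xs)) ⟩
  chop (map length rcRuns) (concat rcRuns)
    ≡⟨ chop-concat rcRuns ⟩
  rcRuns ∎
  where
  open ≡-Reasoning
  rcRuns = reverse (map (reverseComplement N) (descRuns xs))
  lengths-agree : map length rcRuns ≡ runLengths (reverseComplement N xs)
  lengths-agree = begin
    map length (reverse (map (reverseComplement N) (descRuns xs)))
      ≡⟨ reverse-map length (map (reverseComplement N) (descRuns xs)) ⟩
    reverse (map length (map (reverseComplement N) (descRuns xs)))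
      ≡⟨ cong reverse (map-∘ (descRuns xs)) ⟨
    reverse (map (length ∘ reverseComplement N) (descRuns xs))
      ≡⟨ cong reverse (map-cong (length-reverseComplement N) (descRuns xs)) ⟩
    reverse (runLengths xs)
      ≡⟨ runLengths-reverseComplement N xs xs≤N ⟨
    runLengths (reverseComplement N xs) ∎

Pop-reverseComplement : ∀ N xs → All (_≤ N) xs →
  Pop (reverseComplement N xs) ≡ reverseComplement N (Pop xs)
Pop-reverseComplement N xs xs≤N = begin
  concat (map reverse (descRuns (reverseComplement N xs)))
    ≡⟨ cong (concat ∘ map reverse) (descRuns-reverseComplement N xs xs≤N) ⟩
  concat (map reverse (reverse (map rc runs)))   ≡⟨ cong concat (reverse-map reverse (map rc runs)) ⟩
  concat (reverse (map reverse (map rc runs)))   ≡⟨ cong (concat ∘ reverse) (map-∘ runs) ⟨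
  concat (reverse (map (reverse ∘ rc) runs))     ≡⟨ cong (concat ∘ reverse) (map-cong rc-reverse runs) ⟩
  concat (reverse (map (rc ∘ reverse) runs))     ≡⟨ cong (concat ∘ reverse) (map-∘ runs) ⟩
  concat (reverse (map rc (map reverse runs)))   ≡⟨ reverseComplement-concat N (map reverse runs) ⟨
  rc (concat (map reverse runs))                 ∎
  where
  open ≡-Reasoning
  rc = reverseComplement N
  runs = descRuns xs
  rc-reverse : ∀ ys → reverse (rc ys) ≡ rc (reverse ys)
  rc-reverse ys = begin
    reverse (map (N ∸_) (reverse ys))   ≡⟨ cong reverse (reverse-map (N ∸_) ys) ⟩
    reverse (reverse (map (N ∸_) ys))   ≡⟨ reverse-involutive (map (N ∸_) ys) ⟩
    map (N ∸_) ys                       ≡⟨ cong (map (N ∸_)) (reverse-involutive ys) ⟨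
    rc (reverse ys)                     ∎

Pop^-reverseComplement : ∀ N k xs → All (_≤ N) xs →
  Pop^ k (reverseComplement N xs) ≡ reverseComplement N (Pop^ k xs)
Pop^-reverseComplement N zero    xs xs≤N = refl
Pop^-reverseComplement N (suc k) xs xs≤N =
  trans (cong Pop (Pop^-reverseComplement N k xs xs≤N))
        (Pop-reverseComplement N (Pop^ k xs) (All-resp-↭ (↭-sym (Pop^-↭ k xs)) xs≤N))

reverseComplement-idPerm : ∀ m → reverseComplement (suc m) (idPerm m) ≡ idPerm m
reverseComplement-idPerm m = begin
  map (suc m ∸_) (reverse (applyUpTo suc m))         ≡⟨ cong (map (suc m ∸_)) (reverse-applyUpTo suc m) ⟩
  map (suc m ∸_) (applyDownFrom suc m)               ≡⟨ cong (map (suc m ∸_)) (downFrom-upTo suc m) ⟩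
  map (suc m ∸_) (applyUpTo (λ i → suc (m ∸ suc i)) m) ≡⟨ map-applyUpTo _ (suc m ∸_) m ⟩
  applyUpTo (λ i → m ∸ (m ∸ suc i)) m                ≡⟨ applyUpTo-cong-< m m∸[m∸n]≡n ⟩
  applyUpTo suc m                                    ∎
  where
  open ≡-Reasoning
  downFrom-upTo : ∀ (f : ℕ → ℕ) m → applyDownFrom f m ≡ applyUpTo (λ i → f (m ∸ suc i)) m
  downFrom-upTo f zero    = refl
  downFrom-upTo f (suc m) = cong (f m ∷_) (downFrom-upTo f m)
  applyUpTo-cong-< : ∀ {f g : ℕ → ℕ} m → (∀ {i} → i < m → f i ≡ g i) → applyUpTo f m ≡ applyUpTo g m
  applyUpTo-cong-< zero    f≡g = refl
  applyUpTo-cong-< (suc m) f≡g = cong₂ _∷_ (f≡g z<s) (applyUpTo-cong-< m (f≡g ∘ s<s))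

unPop : List ℕ → List ℕ → List ℕ
unPop ks xs = concat (map reverse (chop ks xs))

unPop-Pop : ∀ xs → unPop (runLengths xs) (Pop xs) ≡ xs
unPop-Pop xs = begin
  concat (map reverse (chop (map length runs) (concat (map reverse runs))))
    ≡⟨ cong (λ ks → unPop ks (concat (map reverse runs))) lengths-reverse ⟨
  concat (map reverse (chop (map length (map reverse runs)) (concat (map reverse runs))))
    ≡⟨ cong (concat ∘ map reverse) (chop-concat (map reverse runs)) ⟩
  concat (map reverse (map reverse runs))   ≡⟨ cong concat (map-∘ runs) ⟨
  concat (map (reverse ∘ reverse) runs)     ≡⟨ cong concat (map-cong reverse-involutive runs) ⟩
  concat (map id runs)                      ≡⟨ cong concat (map-id runs) ⟩
  concat runs                               ≡⟨ concat-descRuns xs ⟩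
  xs                                        ∎
  where
  open ≡-Reasoning
  runs = descRuns xs
  lengths-reverse : map length (map reverse runs) ≡ map length runs
  lengths-reverse = trans (sym (map-∘ runs)) (map-cong length-reverse runs)

≡-by-runLengths-Pop : ∀ {xs ys} → runLengths xs ≡ runLengths ys → Pop xs ≡ Pop ys → xs ≡ ys
≡-by-runLengths-Pop {xs} {ys} same-lengths same-Pop = begin
  xs                             ≡⟨ unPop-Pop xs ⟨
  unPop (runLengths xs) (Pop xs) ≡⟨ cong₂ unPop same-lengths same-Pop ⟩
  unPop (runLengths ys) (Pop ys) ≡⟨ unPop-Pop ys ⟩
  ys                             ∎
  where open ≡-Reasoning

≡-by-sortingPlan : ∀ t {xs ys} → (∀ {j} → j < t → runLengths (Pop^ j xs) ≡ runLengths (Pop^ j ys)) →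
                   Pop^ t xs ≡ Pop^ t ys → xs ≡ ys
≡-by-sortingPlan zero    same-rows same-Pop^ = same-Pop^
≡-by-sortingPlan (suc t) same-rows same-Pop^ = ≡-by-sortingPlan t (same-rows ∘ m<n⇒m<1+n)
  (≡-by-runLengths-Pop (same-rows ≤-refl) same-Pop^)

lemma4p6 : (t n : ℕ) → t ≥ 1 → n ≥ 1 → (w : List ℕ) →
    IsPerm (n + n) w → Sortable (n + n) t w →
    TypeBPlan (n + n) (sortingPlan t w) ⇔ InB n w
lemma4p6 t n _ _ w w-perm w-sortable = mk⇔ symmetric⇒InB InB⇒symmetric
  where
  N = suc (n + n)
  rc = reverseComplement N
  w≤N : All (_≤ N) w
  w≤N = All-resp-↭ (↭-sym w-perm) (applyUpTo⁺₁ suc (n + n) (λ i<2n → m≤n⇒m≤1+n i<2n))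
  row-rc : ∀ j → runLengths (Pop^ j (rc w)) ≡ reverse (runLengths (Pop^ j w))
  row-rc j = trans (cong runLengths (Pop^-reverseComplement N j w w≤N))
                   (runLengths-reverseComplement N (Pop^ j w) (All-resp-↭ (↭-sym (Pop^-↭ j w)) w≤N))
  symmetric⇒InB : TypeBPlan (n + n) (sortingPlan t w) → InB n w
  symmetric⇒InB (palindromes , _) = ≡-by-sortingPlan t
    (λ {j} j<t → trans (row-rc j) (applyUpTo⁻ _ t palindromes j<t))
    (begin
      Pop^ t (rc w)   ≡⟨ Pop^-reverseComplement N t w w≤N ⟩
      rc (Pop^ t w)   ≡⟨ cong rc w-sortable ⟩
      rc (idPerm (n + n)) ≡⟨ reverseComplement-idPerm (n + n) ⟩
      idPerm (n + n)  ≡⟨ w-sortable ⟨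
      Pop^ t w        ∎)
    where open ≡-Reasoning
  InB⇒symmetric : InB n w → TypeBPlan (n + n) (sortingPlan t w)
  InB⇒symmetric rc-w≡w =
    applyUpTo⁺₁ _ t (λ {j} _ → trans (sym (row-rc j)) (cong (runLengths ∘ Pop^ j) rc-w≡w)) , n , refl
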